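{- Let $\mathcal{C}$ be a class of instances and let $K$ be the semiring $\mathbb{B}$ or $\mathbb{N}$. Then the following are equivalent: (1) $\mathcal{C}$ admits a left query algorithm $(\mathcal{F},X)$ over $K$; (2) $\mathcal{C}$ admits a left query algorithm $(\mathcal{F},X)$ over $K$ in which every instance in $\mathcal{F}$ is connected.
   Context: An instance $A$ over a schema (finite set of relation symbols with arities) assigns to each relation symbol a finite relation of that arity; $\mathrm{adom}(A)$ is the set of entries of its tuples. A homomorphism $A\to B$ is a map $\mathrm{adom}(A)\to\mathrm{adom}(B)$ mapping tuples of each $R^A$ into $R^B$. A class of instances is a collection of instances over a fixed schema closed under isomorphism. $A$ is connected if any two elements of $\mathrm{adom}(A)$ are joined by a sequence of elements in which consecutive elements occur together in some tuple of $A$. $\hom_{\mathbb{N}}(A,B)$ is the number of homomorphisms $A\to B$, $\hom_{\mathbb{B}}(A,B)$ is $1$ if one exists and $0$ otherwise. A left $k$-query algorithm over $K$ for $\mathcal{C}$ is a pair $(\mathcal{F},X)$ with $\mathcal{F}=\{F_1,\dots,F_k\}$ a finite set of instances and $X$ a set of $k$-tuples over $K$ such that for every instance $D$: $D\in\mathcal{C}$ iff $(\hom_K(F_1,D),\dots,\hom_K(F_k,D))\in X$; a left query algorithm is a left $k$-query algorithm for some $k>0$. -}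

module Defs where

open import Data.Nat using (ℕ; zero; suc; _≡ᵇ_; _<_; _≟_)
open import Data.Bool using (Bool; true; false; if_then_else_; _∧_)
open import Data.Fin using (Fin)
open import Data.Bool.ListAction using (all; any)
open import Data.Vec using (Vec)
import Data.Vec as V
open import Data.Vec.Properties using (≡-dec)
open import Data.List using (List; []; _∷_; concatMap; map; length; filter; deduplicate; allFin; [_])
import Data.List.Membership.Propositional as LM
import Data.Vec.Membership.Propositional as VM
open import Data.Product using (Σ; ∃; ∃-syntax; _×_; _,_)
open import Relation.Nullary using (isYes)
open import Relation.Binary.PropositionalEquality using (_≡_)
open import Relation.Binary.Construct.Closure.ReflexiveTransitive using (Star)

record Schema : Set where
  field
    nsym  : ℕ
    arity : Fin nsym → ℕ
open Schema public

-- An instance: each relation symbol is assigned a finite relation, given as a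
-- finite list of tuples (the relation is the set of listed tuples).
-- Elements are natural numbers (every finite instance is isomorphic to one of these).
Instance : Schema → Set
Instance σ = (R : Fin (nsym σ)) → List (Vec ℕ (arity σ R))

_∈adom_ : {σ : Schema} → ℕ → Instance σ → Set
_∈adom_ {σ} x A = ∃[ R ] ∃[ t ] (t LM.∈ A R × x VM.∈ t)

Iso : {σ : Schema} → Instance σ → Instance σ → Set
Iso {σ} A B = Σ (ℕ → ℕ) λ f → Σ (ℕ → ℕ) λ g →
    ((x : ℕ) → x ∈adom A → (f x ∈adom B) × (g (f x) ≡ x))
  × ((y : ℕ) → y ∈adom B → (g y ∈adom A) × (f (g y) ≡ y))
  × ((R : Fin (nsym σ)) (t : Vec ℕ (arity σ R)) → t LM.∈ A R → V.map f t LM.∈ B R)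
  × ((R : Fin (nsym σ)) (t : Vec ℕ (arity σ R)) → t LM.∈ B R → V.map g t LM.∈ A R)

record Class (σ : Schema) : Set₁ where
  field
    member    : Instance σ → Set
    iso-closed : (A B : Instance σ) → Iso A B → member A → member B
open Class public

Adjacent : {σ : Schema} → Instance σ → ℕ → ℕ → Set
Adjacent {σ} A x y = ∃[ R ] ∃[ t ] (t LM.∈ A R × x VM.∈ t × y VM.∈ t)

Connected : {σ : Schema} → Instance σ → Set
Connected A = (x y : ℕ) → x ∈adom A → y ∈adom A → Star (Adjacent A) x y

adomList : {σ : Schema} → Instance σ → List ℕ
adomList {σ} A = deduplicate _≟_ (concatMap (λ R → concatMap V.toList (A R)) (allFin (nsym σ)))

assignments : ℕ → List ℕ → List (List ℕ)
assignments zero    ys = [ [] ]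
assignments (suc k) ys = concatMap (λ y → map (y ∷_) (assignments k ys)) ys

assoc : List ℕ → List ℕ → ℕ → ℕ
assoc []       _        x = 0
assoc (a ∷ as) []       x = 0
assoc (a ∷ as) (y ∷ ys) x = if a ≡ᵇ x then y else assoc as ys x

memᵇ : {n : ℕ} → Vec ℕ n → List (Vec ℕ n) → Bool
memᵇ v ts = any (λ u → isYes (≡-dec _≟_ u v)) ts

isHomᵇ : {σ : Schema} → Instance σ → Instance σ → (ℕ → ℕ) → Bool
isHomᵇ {σ} A B h = all (λ R → all (λ t → memᵇ (V.map h t) (B R)) (A R)) (allFin (nsym σ))

-- number of homomorphisms A → B (maps adom(A) → adom(B) sending tuples into relations)
homN : {σ : Schema} → Instance σ → Instance σ → ℕ
homN A B = length (filter (λ ys → isHomᵇ A B (assoc (adomList A) ys) Data.Bool.≟ true)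
                          (assignments (length (adomList A)) (adomList B)))

data Semiring : Set where
  𝔹 ℕˢ : Semiring

Carrier : Semiring → Set
Carrier 𝔹  = Bool
Carrier ℕˢ = ℕ

homK : {σ : Schema} → (K : Semiring) → Instance σ → Instance σ → Carrier K
homK 𝔹  A B with homN A B
... | zero  = false
... | suc _ = true
homK ℕˢ A B = homN A B

IsLeftQueryAlg : {σ : Schema} → (K : Semiring) → Class σ → (k : ℕ) →
                 Vec (Instance σ) k → (Vec (Carrier K) k → Set) → Set
IsLeftQueryAlg {σ} K C k F X =
  (D : Instance σ) → (member C D → X (V.map (λ Fi → homK K Fi D) F))
                   × (X (V.map (λ Fi → homK K Fi D) F) → member C D)

AdmitsLQA : {σ : Schema} → (K : Semiring) → Class σ → Set₁
AdmitsLQA {σ} K C = ∃[ k ] (0 < k) × Σ (Vec (Instance σ) k) λ F →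
  Σ (Vec (Carrier K) k → Set) λ X → IsLeftQueryAlg K C k F X

AdmitsConnectedLQA : {σ : Schema} → (K : Semiring) → Class σ → Set₁
AdmitsConnectedLQA {σ} K C = ∃[ k ] (0 < k) × Σ (Vec (Instance σ) k) λ F →
  Σ (Vec (Carrier K) k → Set) λ X →
    ((i : Fin k) → Connected (V.lookup F i)) × IsLeftQueryAlg K C k F X

-- Connected components multiply: hom(A ⊎ B, D) = hom(A, D) · hom(B, D) whenever A and B have
-- disjoint active domains, and over 𝔹 the product becomes a conjunction. Hence every instance Fᵢ
-- of a left query algorithm can be replaced by its connected components, provided X is
-- precomposed with the map that multiplies the component values back together.
--
-- The components of G are computed by a labelling of its elements: processing the tuples one by
-- one, all labels occurring in a tuple are merged into one. At the end two elements share a label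
-- iff they are joined by a path of tuples, and every tuple is label-homogeneous. Splitting G by
-- "meets the label of a" for each element a of a list covering adom(G) yields one piece per
-- element plus a remainder with empty active domain; pieces may be empty. Splitting every Fᵢ
-- along the same list gives all of them the same number of pieces, so the new family can be
-- indexed by pairs (i , j) through Fin.combine.

module Submission where

open import Data.Bool using (Bool; true; false; if_then_else_; _∧_; not; T)
import Data.Bool as Bool
open import Data.Bool.ListAction using (all)
open import Data.Bool.Properties using (T-∧; T?)
open import Data.Empty using (⊥; ⊥-elim)
open import Data.Fin using (Fin; combine; remQuot) renaming (zero to fzero; suc to fsuc)
open import Data.Fin.Properties using (remQuot-combine)
open import Data.List using (List; []; _∷_; _++_; map; length; filter; concatMap; allFin)
open import Data.List.Membership.Propositional using (_∈_; find; lose)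
open import Data.List.Membership.Propositional.Properties
  using ( ∈-concatMap⁺; ∈-concatMap⁻; ∈-allFin; deduplicate-∈⇔; ++-∈⇔
        ; ∈-map⁺; ∈-map⁻; ∈-filter⁺; ∈-filter⁻)
open import Data.List.Membership.Propositional.Properties.WithK using (unique∧set⇒bag)
open import Data.List.Properties using (map-cong; length-++; filter-++)
open import Data.List.Relation.Binary.BagAndSetEquality using (∼bag⇒↭)
open import Data.List.Relation.Binary.Disjoint.Propositional using (Disjoint)
open import Data.List.Relation.Binary.Permutation.Propositional using (_↭_; prep; swap)
import Data.List.Relation.Binary.Permutation.Propositional as ↭
import Data.List.Relation.Unary.All as All
open import Data.List.Relation.Unary.All.Properties using (all⁺; all⁻)
open import Data.List.Relation.Unary.Any using (here; there)
import Data.List.Relation.Unary.Any as Any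
open import Data.List.Relation.Unary.Any.Properties using (any⁺; any⁻; ¬Any[])
open import Data.List.Relation.Unary.Unique.Propositional using (Unique)
open import Data.List.Relation.Unary.Unique.Propositional.Properties using (++⁺)
open import Data.List.Relation.Unary.Unique.DecPropositional.Properties using (deduplicate-!)
open import Data.Nat using (ℕ; zero; suc; _+_; _*_; _≡ᵇ_; _≟_; s≤s; z≤n)
open import Data.Nat.ListAction using (sum)
open import Data.Nat.Properties
  using (≡ᵇ⇒≡; ≡⇒≡ᵇ; *-identityˡ; *-identityʳ; *-zeroʳ; *-distribʳ-+; +-commutativeSemigroup)
open import Algebra.Properties.CommutativeSemigroup +-commutativeSemigroup using (interchange)
open import Data.Product using (Σ; _×_; _,_; proj₁; proj₂; uncurry)
open import Data.Product.Function.NonDependent.Propositional using (_×-⇔_)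
open import Data.Sum using (_⊎_; inj₁; inj₂; [_,_])
import Data.Sum as Sum
open import Data.Sum.Function.Propositional using (_⊎-⇔_)
open import Data.Vec using (Vec)
import Data.Vec as V
import Data.Vec.Properties as V
import Data.Vec.Membership.Propositional as VM
open import Data.Vec.Membership.Propositional.Properties using (∈-toList⁺; ∈-toList⁻; ∈-lookup)
import Data.Vec.Relation.Unary.Any as VAny
open import Function using (_∘_; const)
open import Function.Bundles using (_⇔_; mk⇔; Equivalence)
open import Function.Properties.Equivalence using () renaming (trans to ⇔-trans; sym to ⇔-sym)
open import Relation.Binary.Construct.Closure.ReflexiveTransitive using (Star; ε; _◅_; _◅◅_)
import Relation.Binary.Construct.Closure.ReflexiveTransitive as Star
open import Relation.Binary.PropositionalEquality
  using (_≡_; _≢_; refl; sym; cong; cong₂; module ≡-Reasoning)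
import Relation.Binary.PropositionalEquality as ≡
open import Relation.Nullary using (¬_; Dec; yes; no; does)
open import Relation.Nullary.Decidable using (⌊_⌋; toWitness; fromWitness)
import Relation.Unary

open import Defs

T-injective : ∀ {b c} → T b ⇔ T c → b ≡ c
T-injective {false} {false} _   = refl
T-injective {false} {true}  b⇔c = ⊥-elim (Equivalence.from b⇔c _)
T-injective {true}  {false} b⇔c = ⊥-elim (Equivalence.to b⇔c _)
T-injective {true}  {true}  _   = refl

T-not⇒¬T : ∀ {b} → T (not b) → ¬ T b
T-not⇒¬T {false} _ ()

T-∧-split : ∀ b c → T b → T (b ∧ c) ⊎ T (b ∧ not c)
T-∧-split true true  _ = inj₁ _
T-∧-split true false _ = inj₂ _

map-cong-∈ : ∀ {A B : Set} {f g : A → B} {n} (t : Vec A n) →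
             (∀ {x} → x VM.∈ t → f x ≡ g x) → V.map f t ≡ V.map g t
map-cong-∈ V.[]      f≡g = refl
map-cong-∈ (x V.∷ t) f≡g = cong₂ V._∷_ (f≡g (VAny.here refl)) (map-cong-∈ t (f≡g ∘ VAny.there))

tabulate-lookup-map : ∀ {A B : Set} {n} (h : A → B) (xs : Vec A n) → V.tabulate (h ∘ V.lookup xs) ≡ V.map h xs
tabulate-lookup-map h xs = ≡.trans (V.tabulate-∘ h (V.lookup xs)) (cong (V.map h) (V.tabulate∘lookup xs))

sumMap : {A : Set} → List A → (A → ℕ) → ℕ
sumMap xs g = sum (map g xs)

sumMap-cong : {A : Set} (xs : List A) {g h : A → ℕ} → (∀ x → g x ≡ h x) → sumMap xs g ≡ sumMap xs h
sumMap-cong xs g≗h = cong sum (map-cong g≗h xs)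

sumMap-zero : {A : Set} (xs : List A) → sumMap xs (const 0) ≡ 0
sumMap-zero []       = refl
sumMap-zero (_ ∷ xs) = sumMap-zero xs

sumMap-+ : {A : Set} (xs : List A) (g h : A → ℕ) → sumMap xs (λ x → g x + h x) ≡ sumMap xs g + sumMap xs h
sumMap-+ []       g h = refl
sumMap-+ (x ∷ xs) g h =
  ≡.trans (cong (g x + h x +_) (sumMap-+ xs g h)) (interchange (g x) (h x) _ _)

sumMap-comm : {A B : Set} (xs : List A) (ys : List B) (h : A → B → ℕ) →
              sumMap xs (λ x → sumMap ys (h x)) ≡ sumMap ys (λ y → sumMap xs (λ x → h x y))
sumMap-comm []       ys h = sym (sumMap-zero ys)
sumMap-comm (x ∷ xs) ys h =
  ≡.trans (cong (sumMap ys (h x) +_) (sumMap-comm xs ys h)) (sym (sumMap-+ ys (h x) _))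

sumMap-*ʳ : {A : Set} (xs : List A) (g : A → ℕ) (d : ℕ) → sumMap xs (λ x → g x * d) ≡ sumMap xs g * d
sumMap-*ʳ []       g d = refl
sumMap-*ʳ (x ∷ xs) g d = ≡.trans (cong (g x * d +_) (sumMap-*ʳ xs g d)) (sym (*-distribʳ-+ d (g x) _))

module _ {A B : Set} {P : B → Set} (P? : Relation.Unary.Decidable P) where

  length-filter-map : (f : A → B) (xs : List A) →
                      length (filter P? (map f xs)) ≡ length (filter (P? ∘ f) xs)
  length-filter-map f []       = refl
  length-filter-map f (x ∷ xs) with does (P? (f x))
  ... | true  = cong suc (length-filter-map f xs)
  ... | false = length-filter-map f xs

  length-filter-concatMap : (g : A → List B) (xs : List A) →
                            length (filter P? (concatMap g xs)) ≡ sumMap xs (λ x → length (filter P? (g x)))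
  length-filter-concatMap g []       = refl
  length-filter-concatMap g (x ∷ xs) = begin
    length (filter P? (g x ++ concatMap g xs))                     ≡⟨ cong length (filter-++ P? (g x) _) ⟩
    length (filter P? (g x) ++ filter P? (concatMap g xs))         ≡⟨ length-++ (filter P? (g x)) ⟩
    length (filter P? (g x)) + length (filter P? (concatMap g xs)) ≡⟨ cong (_ +_) (length-filter-concatMap g xs) ⟩
    length (filter P? (g x)) + sumMap xs (λ x → length (filter P? (g x))) ∎
    where open ≡-Reasoning

-- Counting maps

_[_↦_] : (ℕ → ℕ) → ℕ → ℕ → ℕ → ℕ
(f [ a ↦ y ]) x = if a ≡ᵇ x then y else f x

-- The number of maps from L to M satisfying P; as in assoc, points outside L are sent to 0.
countMaps : List ℕ → List ℕ → ((ℕ → ℕ) → Bool) → ℕ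
countMaps []      M P = if P (const 0) then 1 else 0
countMaps (a ∷ L) M P = sumMap M (λ y → countMaps L M (λ f → P (f [ a ↦ y ])))

count-assignments : ∀ L M P →
  length (filter (λ ys → P (assoc L ys) Bool.≟ true) (assignments (length L) M)) ≡ countMaps L M P
count-assignments []      M P with P (const 0)
... | true  = refl
... | false = refl
count-assignments (a ∷ L) M P = begin
  length (filter P? (concatMap (λ y → map (y ∷_) (assignments (length L) M)) M))
    ≡⟨ length-filter-concatMap P? _ M ⟩
  sumMap M (λ y → length (filter P? (map (y ∷_) (assignments (length L) M))))
    ≡⟨ sumMap-cong M (λ y → length-filter-map P? (y ∷_) (assignments (length L) M)) ⟩
  sumMap M (λ y → length (filter (P? ∘ (y ∷_)) (assignments (length L) M)))
    ≡⟨ sumMap-cong M (λ y → count-assignments L M (λ f → P (f [ a ↦ y ]))) ⟩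
  countMaps (a ∷ L) M P ∎
  where
  open ≡-Reasoning
  P? = λ ys → P (assoc (a ∷ L) ys) Bool.≟ true

homN≡countMaps : ∀ {σ} (A B : Instance σ) → homN A B ≡ countMaps (adomList A) (adomList B) (isHomᵇ A B)
homN≡countMaps A B = count-assignments (adomList A) (adomList B) (isHomᵇ A B)

[↦]-at : ∀ f a y → (f [ a ↦ y ]) a ≡ y
[↦]-at f a y with a ≡ᵇ a in eq
... | true  = refl
... | false = ⊥-elim (≡.subst T eq (≡⇒≡ᵇ a a refl))

[↦]-off : ∀ f {a x} y → a ≢ x → (f [ a ↦ y ]) x ≡ f x
[↦]-off f {a} {x} y a≢x with a ≡ᵇ x in eq
... | true  = ⊥-elim (a≢x (≡ᵇ⇒≡ a x (≡.subst T (sym eq) _)))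
... | false = refl

[↦]-cong : ∀ f g a y {x} → (a ≢ x → f x ≡ g x) → (f [ a ↦ y ]) x ≡ (g [ a ↦ y ]) x
[↦]-cong f g a y {x} f≡g with a ≟ x
... | yes refl = ≡.trans ([↦]-at f a y) (sym ([↦]-at g a y))
... | no a≢x   = ≡.trans ([↦]-off f y a≢x) (≡.trans (f≡g a≢x) (sym ([↦]-off g y a≢x)))

[↦]-comm : ∀ f {a b} y z → a ≢ b → ∀ x → ((f [ b ↦ z ]) [ a ↦ y ]) x ≡ ((f [ a ↦ y ]) [ b ↦ z ]) x
[↦]-comm f {a} {b} y z a≢b x with a ≟ x | b ≟ x
... | yes refl | yes refl = ⊥-elim (a≢b refl)
... | yes refl | no b≢x   =
  ≡.trans ([↦]-at (f [ b ↦ z ]) a y) (sym (≡.trans ([↦]-off (f [ a ↦ y ]) z b≢x) ([↦]-at f a y)))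
... | no a≢x   | yes refl =
  ≡.trans ([↦]-off (f [ b ↦ z ]) y a≢x) (≡.trans ([↦]-at f b z) (sym ([↦]-at (f [ a ↦ y ]) b z)))
... | no a≢x   | no b≢x   = begin
  ((f [ b ↦ z ]) [ a ↦ y ]) x ≡⟨ [↦]-off (f [ b ↦ z ]) y a≢x ⟩
  (f [ b ↦ z ]) x             ≡⟨ [↦]-off f z b≢x ⟩
  f x                         ≡⟨ [↦]-off f y a≢x ⟨
  (f [ a ↦ y ]) x             ≡⟨ [↦]-off (f [ a ↦ y ]) z b≢x ⟨
  ((f [ a ↦ y ]) [ b ↦ z ]) x ∎
  where open ≡-Reasoning

Extensional : ((ℕ → ℕ) → Bool) → Set
Extensional P = ∀ {f g} → (∀ x → f x ≡ g x) → P f ≡ P g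

DependsOnlyOn : ((ℕ → ℕ) → Bool) → List ℕ → Set
DependsOnlyOn P L = ∀ {f g} → (∀ {x} → x ∈ L → f x ≡ g x) → P f ≡ P g

DependsOnlyOn⇒Extensional : ∀ {P L} → DependsOnlyOn P L → Extensional P
DependsOnlyOn⇒Extensional dep f≗g = dep (λ {x} _ → f≗g x)

Extensional-[↦] : ∀ {P} a y → Extensional P → Extensional (λ f → P (f [ a ↦ y ]))
Extensional-[↦] a y ext {f} {g} f≗g = ext (λ x → [↦]-cong f g a y (λ _ → f≗g x))

DependsOnlyOn-[↦] : ∀ {P a L} y → DependsOnlyOn P (a ∷ L) → DependsOnlyOn (λ f → P (f [ a ↦ y ])) L
DependsOnlyOn-[↦] {a = a} y dep {f} {g} f≡g = dep λ
  { (here refl) → [↦]-cong f g a y (λ a≢a → ⊥-elim (a≢a refl))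
  ; (there x∈L) → [↦]-cong f g a y (λ _ → f≡g x∈L) }

countMaps-cong : ∀ L M {P Q} → (∀ f → P f ≡ Q f) → countMaps L M P ≡ countMaps L M Q
countMaps-cong []      M P≗Q = cong (λ b → if b then 1 else 0) (P≗Q (const 0))
countMaps-cong (a ∷ L) M P≗Q = sumMap-cong M (λ y → countMaps-cong L M (λ f → P≗Q (f [ a ↦ y ])))

countMaps-false : ∀ L M → countMaps L M (const false) ≡ 0
countMaps-false []      M = refl
countMaps-false (a ∷ L) M = ≡.trans (sumMap-cong M (λ _ → countMaps-false L M)) (sumMap-zero M)

countMaps-↭ : ∀ {L L′} M {P} → Extensional P → L ↭ L′ → countMaps L M P ≡ countMaps L′ M P
countMaps-↭ M ext ↭.refl = refl
countMaps-↭ M ext (prep a L↭L′) =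
  sumMap-cong M (λ y → countMaps-↭ M (Extensional-[↦] a y ext) L↭L′)
countMaps-↭ M ext (swap a b L↭L′) with a ≟ b
... | yes refl = sumMap-cong M λ y → sumMap-cong M λ z →
                   countMaps-↭ M (Extensional-[↦] a z (Extensional-[↦] a y ext)) L↭L′
countMaps-↭ {_ ∷ _ ∷ L} {_ ∷ _ ∷ L′} M {P} ext (swap a b L↭L′) | no a≢b = begin
  sumMap M (λ y → sumMap M (λ z → countMaps L M (λ f → P ((f [ b ↦ z ]) [ a ↦ y ]))))
    ≡⟨ sumMap-comm M M _ ⟩
  sumMap M (λ z → sumMap M (λ y → countMaps L M (λ f → P ((f [ b ↦ z ]) [ a ↦ y ]))))
    ≡⟨ sumMap-cong M (λ z → sumMap-cong M λ y →
         countMaps-↭ M (Extensional-[↦] b z (Extensional-[↦] a y ext)) L↭L′) ⟩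
  sumMap M (λ z → sumMap M (λ y → countMaps L′ M (λ f → P ((f [ b ↦ z ]) [ a ↦ y ]))))
    ≡⟨ sumMap-cong M (λ z → sumMap-cong M λ y →
         countMaps-cong L′ M (λ f → ext ([↦]-comm f y z a≢b))) ⟩
  sumMap M (λ z → sumMap M (λ y → countMaps L′ M (λ f → P ((f [ a ↦ y ]) [ b ↦ z ])))) ∎
  where open ≡-Reasoning
countMaps-↭ M ext (↭.trans L↭L′ L′↭L″) =
  ≡.trans (countMaps-↭ M ext L↭L′) (countMaps-↭ M ext L′↭L″)

countMaps-++ : ∀ L₁ L₂ M {P₁ P₂} → Disjoint L₁ L₂ → DependsOnlyOn P₁ L₁ → DependsOnlyOn P₂ L₂ →
               countMaps (L₁ ++ L₂) M (λ f → P₁ f ∧ P₂ f) ≡ countMaps L₁ M P₁ * countMaps L₂ M P₂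
countMaps-++ [] L₂ M {P₁} {P₂} _ dep₁ _ with P₁ (const 0) in eq
... | true  = ≡.trans (countMaps-cong L₂ M (λ f → cong (_∧ P₂ f) (≡.trans (dep₁ (λ ())) eq)))
                      (sym (*-identityˡ _))
... | false = ≡.trans (countMaps-cong L₂ M (λ f → cong (_∧ P₂ f) (≡.trans (dep₁ (λ ())) eq)))
                      (countMaps-false L₂ M)
countMaps-++ (a ∷ L₁) L₂ M {P₁} {P₂} disj dep₁ dep₂ = begin
  sumMap M (λ y → countMaps (L₁ ++ L₂) M (λ f → P₁ (f [ a ↦ y ]) ∧ P₂ (f [ a ↦ y ])))
    ≡⟨ sumMap-cong M (λ y → countMaps-cong (L₁ ++ L₂) M (λ f →
         cong (P₁ (f [ a ↦ y ]) ∧_) (dep₂ ([↦]-off f y ∘ a∉L₂)))) ⟩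
  sumMap M (λ y → countMaps (L₁ ++ L₂) M (λ f → P₁ (f [ a ↦ y ]) ∧ P₂ f))
    ≡⟨ sumMap-cong M (λ y → countMaps-++ L₁ L₂ M (λ (x∈L₁ , x∈L₂) → disj (there x∈L₁ , x∈L₂))
                              (DependsOnlyOn-[↦] y dep₁) dep₂) ⟩
  sumMap M (λ y → countMaps L₁ M (λ f → P₁ (f [ a ↦ y ])) * countMaps L₂ M P₂)
    ≡⟨ sumMap-*ʳ M _ _ ⟩
  countMaps (a ∷ L₁) M P₁ * countMaps L₂ M P₂ ∎
  where
  open ≡-Reasoning
  a∉L₂ : ∀ {x} → x ∈ L₂ → a ≢ x
  a∉L₂ x∈L₂ refl = disj (here refl , x∈L₂)

module _ {σ : Schema} where

  ∈-adomList : ∀ (A : Instance σ) {x} → x ∈ adomList A ⇔ x ∈adom A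
  ∈-adomList A {x} = mk⇔ to from
    where
    elems : Fin (nsym σ) → List ℕ
    elems R = concatMap V.toList (A R)
    to : x ∈ adomList A → x ∈adom A
    to x∈ =
      let R , _ , x∈R = find (∈-concatMap⁻ elems {xs = allFin _} (Equivalence.from (deduplicate-∈⇔ _≟_) x∈))
          t , t∈ , x∈t = find (∈-concatMap⁻ V.toList {xs = A R} x∈R)
      in R , t , t∈ , ∈-toList⁻ x∈t
    from : x ∈adom A → x ∈ adomList A
    from (R , t , t∈ , x∈t) = Equivalence.to (deduplicate-∈⇔ _≟_)
      (∈-concatMap⁺ elems (lose (∈-allFin R) (∈-concatMap⁺ V.toList (lose t∈ (∈-toList⁺ x∈t)))))

  adomList-↭ : ∀ (A : Instance σ) {L} → Unique L → (∀ {x} → x ∈adom A ⇔ x ∈ L) → adomList A ↭ L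
  adomList-↭ A uL adom⇔L =
    ∼bag⇒↭ (unique∧set⇒bag (deduplicate-! _≟_ _) uL (⇔-trans (∈-adomList A) adom⇔L))

  IsHom : Instance σ → Instance σ → (ℕ → ℕ) → Set
  IsHom A D f = ∀ R t → t ∈ A R → V.map f t ∈ D R

  memᵇ-reflects : ∀ {n} (v : Vec ℕ n) ts → T (memᵇ v ts) ⇔ v ∈ ts
  memᵇ-reflects v ts = mk⇔
    (Any.map (sym ∘ toWitness) ∘ any⁻ _ ts)
    (any⁺ _ ∘ Any.map (λ { refl → fromWitness refl }))

  isHomᵇ-reflects : ∀ (A D : Instance σ) f → T (isHomᵇ A D f) ⇔ IsHom A D f
  isHomᵇ-reflects A D f = mk⇔
    (λ hom R t t∈ → Equivalence.to (memᵇ-reflects _ (D R))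
       (All.lookup (all⁺ (tupleOk R) (A R) (All.lookup (all⁺ relationOk (allFin _) hom) (∈-allFin R))) t∈))
    (λ hom → all⁻ relationOk {xs = allFin _} (All.tabulate λ {R} _ → all⁻ (tupleOk R) (All.tabulate λ t∈ →
       Equivalence.from (memᵇ-reflects _ (D R)) (hom R _ t∈))))
    where
    tupleOk : ∀ R → Vec ℕ (arity σ R) → Bool
    tupleOk R t = memᵇ (V.map f t) (D R)
    relationOk : Fin (nsym σ) → Bool
    relationOk R = all (tupleOk R) (A R)

  isHomᵇ-local : ∀ (A D : Instance σ) → DependsOnlyOn (isHomᵇ A D) (adomList A)
  isHomᵇ-local A D {f} {g} f≡g =
    T-injective (⇔-trans (isHomᵇ-reflects A D f) (⇔-trans (mk⇔ (transport f≡g) (transport (sym ∘ f≡g)))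
                                                           (⇔-sym (isHomᵇ-reflects A D g))))
    where
    transport : ∀ {f g} → (∀ {x} → x ∈ adomList A → f x ≡ g x) → IsHom A D f → IsHom A D g
    transport f≡g hom R t t∈ = ≡.subst (_∈ D R)
      (map-cong-∈ t (λ x∈t → f≡g (Equivalence.from (∈-adomList A) (R , t , t∈ , x∈t)))) (hom R t t∈)

  SameTuples : Instance σ → Instance σ → Set
  SameTuples A B = ∀ R t → t ∈ A R ⇔ t ∈ B R

  IsUnion : Instance σ → Instance σ → Instance σ → Set
  IsUnion A A₁ A₂ = ∀ R t → t ∈ A R ⇔ (t ∈ A₁ R ⊎ t ∈ A₂ R)

  DisjointAdoms : Instance σ → Instance σ → Set
  DisjointAdoms A₁ A₂ = ∀ {x} → x ∈adom A₁ → x ∈adom A₂ → ⊥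

  ∈adom-cong : ∀ {A B} → SameTuples A B → ∀ {x} → x ∈adom A ⇔ x ∈adom B
  ∈adom-cong A≈B = mk⇔
    (λ (R , t , t∈ , x∈t) → R , t , Equivalence.to (A≈B R t) t∈ , x∈t)
    (λ (R , t , t∈ , x∈t) → R , t , Equivalence.from (A≈B R t) t∈ , x∈t)

  ∈adom-∪ : ∀ {A A₁ A₂} → IsUnion A A₁ A₂ → ∀ {x} → x ∈adom A ⇔ (x ∈adom A₁ ⊎ x ∈adom A₂)
  ∈adom-∪ A≡A₁∪A₂ = mk⇔
    (λ (R , t , t∈ , x∈t) →
       Sum.map (λ t∈₁ → R , t , t∈₁ , x∈t) (λ t∈₂ → R , t , t∈₂ , x∈t)
               (Equivalence.to (A≡A₁∪A₂ R t) t∈))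
    [ (λ (R , t , t∈ , x∈t) → R , t , Equivalence.from (A≡A₁∪A₂ R t) (inj₁ t∈) , x∈t)
    , (λ (R , t , t∈ , x∈t) → R , t , Equivalence.from (A≡A₁∪A₂ R t) (inj₂ t∈) , x∈t) ]

  IsHom-cong : ∀ {A B} D f → SameTuples A B → IsHom A D f ⇔ IsHom B D f
  IsHom-cong D f A≈B = mk⇔
    (λ hom R t → hom R t ∘ Equivalence.from (A≈B R t))
    (λ hom R t → hom R t ∘ Equivalence.to (A≈B R t))

  IsHom-∪ : ∀ {A A₁ A₂} D f → IsUnion A A₁ A₂ → IsHom A D f ⇔ (IsHom A₁ D f × IsHom A₂ D f)
  IsHom-∪ D f A≡A₁∪A₂ = mk⇔
    (λ hom → (λ R t → hom R t ∘ Equivalence.from (A≡A₁∪A₂ R t) ∘ inj₁)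
           , (λ R t → hom R t ∘ Equivalence.from (A≡A₁∪A₂ R t) ∘ inj₂))
    (λ (hom₁ , hom₂) R t → [ hom₁ R t , hom₂ R t ] ∘ Equivalence.to (A≡A₁∪A₂ R t))

  homN-via : ∀ {A L P} (D : Instance σ) → adomList A ↭ L → (∀ f → isHomᵇ A D f ≡ P f) →
             homN A D ≡ countMaps L (adomList D) P
  homN-via {A} {L} {P} D adomA↭L hom≗P = begin
    homN A D
      ≡⟨ homN≡countMaps A D ⟩
    countMaps (adomList A) (adomList D) (isHomᵇ A D)
      ≡⟨ countMaps-↭ _ (DependsOnlyOn⇒Extensional (isHomᵇ-local A D)) adomA↭L ⟩
    countMaps L (adomList D) (isHomᵇ A D)
      ≡⟨ countMaps-cong L (adomList D) hom≗P ⟩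
    countMaps L (adomList D) P ∎
    where open ≡-Reasoning

  homN-cong : ∀ {A B} (D : Instance σ) → SameTuples A B → homN A D ≡ homN B D
  homN-cong {A} {B} D A≈B = ≡.trans
    (homN-via {A} D
      (adomList-↭ A (deduplicate-! _≟_ _) (⇔-trans (∈adom-cong {A} {B} A≈B) (⇔-sym (∈-adomList B))))
      (λ f → T-injective (⇔-trans (isHomᵇ-reflects A D f)
                            (⇔-trans (IsHom-cong {A} {B} D f A≈B) (⇔-sym (isHomᵇ-reflects B D f))))))
    (sym (homN≡countMaps B D))

  homN-∪ : ∀ {A A₁ A₂} (D : Instance σ) → IsUnion A A₁ A₂ → DisjointAdoms A₁ A₂ →
           homN A D ≡ homN A₁ D * homN A₂ D
  homN-∪ {A} {A₁} {A₂} D A≡A₁∪A₂ disj = begin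
    homN A D
      ≡⟨ homN-via {A} D adomA↭adomA₁++adomA₂ isHomᵇ-∪ ⟩
    countMaps (adomList A₁ ++ adomList A₂) (adomList D) (λ f → isHomᵇ A₁ D f ∧ isHomᵇ A₂ D f)
      ≡⟨ countMaps-++ _ _ _ disjointLists (isHomᵇ-local A₁ D) (isHomᵇ-local A₂ D) ⟩
    countMaps (adomList A₁) (adomList D) (isHomᵇ A₁ D) * countMaps (adomList A₂) (adomList D) (isHomᵇ A₂ D)
      ≡⟨ cong₂ _*_ (homN≡countMaps A₁ D) (homN≡countMaps A₂ D) ⟨
    homN A₁ D * homN A₂ D ∎
    where
    open ≡-Reasoning
    disjointLists : Disjoint (adomList A₁) (adomList A₂)
    disjointLists (x∈₁ , x∈₂) =
      disj (Equivalence.to (∈-adomList A₁) x∈₁) (Equivalence.to (∈-adomList A₂) x∈₂)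
    adomA↭adomA₁++adomA₂ : adomList A ↭ adomList A₁ ++ adomList A₂
    adomA↭adomA₁++adomA₂ = adomList-↭ A (++⁺ (deduplicate-! _≟_ _) (deduplicate-! _≟_ _) disjointLists)
      (⇔-trans (∈adom-∪ {A} {A₁} {A₂} A≡A₁∪A₂)
               (⇔-sym (⇔-trans ++-∈⇔ (∈-adomList A₁ ⊎-⇔ ∈-adomList A₂))))
    isHomᵇ-∪ : ∀ f → isHomᵇ A D f ≡ isHomᵇ A₁ D f ∧ isHomᵇ A₂ D f
    isHomᵇ-∪ f = T-injective (⇔-trans (isHomᵇ-reflects A D f) (⇔-trans (IsHom-∪ {A} {A₁} {A₂} D f A≡A₁∪A₂)
      (⇔-sym (⇔-trans T-∧ (isHomᵇ-reflects A₁ D f ×-⇔ isHomᵇ-reflects A₂ D f)))))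

mul : (K : Semiring) → Carrier K → Carrier K → Carrier K
mul 𝔹  = _∧_
mul ℕˢ = _*_

one : (K : Semiring) → Carrier K
one 𝔹  = true
one ℕˢ = 1

prod : (K : Semiring) {n : ℕ} → Vec (Carrier K) n → Carrier K
prod K = V.foldr′ (mul K) (one K)

fromℕ : (K : Semiring) → ℕ → Carrier K
fromℕ 𝔹  zero    = false
fromℕ 𝔹  (suc _) = true
fromℕ ℕˢ n       = n

fromℕ-* : ∀ K m n → fromℕ K (m * n) ≡ mul K (fromℕ K m) (fromℕ K n)
fromℕ-* 𝔹  zero    n       = refl
fromℕ-* 𝔹  (suc m) zero    = cong (fromℕ 𝔹) (*-zeroʳ m)
fromℕ-* 𝔹  (suc m) (suc n) = refl
fromℕ-* ℕˢ m       n       = refl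

fromℕ-prod : ∀ K {n} (ms : Vec ℕ n) → fromℕ K (prod ℕˢ ms) ≡ prod K (V.map (fromℕ K) ms)
fromℕ-prod 𝔹  V.[]       = refl
fromℕ-prod ℕˢ V.[]       = refl
fromℕ-prod K  (m V.∷ ms) = ≡.trans (fromℕ-* K m _) (cong (mul K (fromℕ K m)) (fromℕ-prod K ms))

homK≡fromℕ-homN : ∀ {σ} K (A D : Instance σ) → homK K A D ≡ fromℕ K (homN A D)
homK≡fromℕ-homN 𝔹  A D with homN A D
... | zero  = refl
... | suc _ = refl
homK≡fromℕ-homN ℕˢ A D = refl

-- Connected components

Hits : (ℕ → ℕ) → ∀ {n} → Vec ℕ n → ℕ → Set
Hits lab t d = VAny.Any (λ w → d ≡ lab w) t

hits? : ∀ lab {n} (t : Vec ℕ n) d → Dec (Hits lab t d)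
hits? lab t d = VAny.any? (λ w → d ≟ lab w) t

relabel : (ℕ → ℕ) → ∀ {n} → Vec ℕ n → ℕ → ℕ
relabel lab V.[]      d = d
relabel lab (z V.∷ t) d with hits? lab (z V.∷ t) d
... | yes _ = lab z
... | no  _ = d

relabel-hits : ∀ lab {n} (t : Vec ℕ n) {d d′} →
               Hits lab t d → Hits lab t d′ → relabel lab t d ≡ relabel lab t d′
relabel-hits lab (z V.∷ t) {d} {d′} hd hd′ with hits? lab (z V.∷ t) d | hits? lab (z V.∷ t) d′
... | yes _ | yes _  = refl
... | no ¬h | _      = ⊥-elim (¬h hd)
... | _     | no ¬h′ = ⊥-elim (¬h′ hd′)

relabel-miss : ∀ lab {n} (t : Vec ℕ n) {d} → ¬ Hits lab t d → relabel lab t d ≡ d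
relabel-miss lab V.[]      ¬hd = refl
relabel-miss lab (z V.∷ t) {d} ¬hd with hits? lab (z V.∷ t) d
... | yes hd = ⊥-elim (¬hd hd)
... | no  _  = refl

hits-relabel : ∀ lab {n} (t : Vec ℕ n) {d} → Hits lab t d → Hits lab t (relabel lab t d)
hits-relabel lab (z V.∷ t) {d} hd with hits? lab (z V.∷ t) d
... | yes _ = VAny.here refl
... | no ¬h = ⊥-elim (¬h hd)

module _ {σ : Schema} where

  Tuple : Set
  Tuple = Σ (Fin (nsym σ)) (λ R → Vec ℕ (arity σ R))

  labelling : List Tuple → ℕ → ℕ
  labelling []             x = x
  labelling ((_ , t) ∷ ps) x = relabel (labelling ps) t (labelling ps x)

  labelling-tuple : ∀ {R t ps x y} → (R , t) ∈ ps → x VM.∈ t → y VM.∈ t → labelling ps x ≡ labelling ps y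
  labelling-tuple {t = t} {_ ∷ ps} (here refl) x∈t y∈t =
    relabel-hits (labelling ps) t (VAny.map (cong (labelling ps)) x∈t) (VAny.map (cong (labelling ps)) y∈t)
  labelling-tuple {ps = (_ , t′) ∷ ps} (there p) x∈t y∈t =
    cong (relabel (labelling ps) t′) (labelling-tuple p x∈t y∈t)

  Adjacent-sym : ∀ (G : Instance σ) {x y} → Adjacent G x y → Adjacent G y x
  Adjacent-sym G (R , t , t∈ , x∈t , y∈t) = R , t , t∈ , y∈t , x∈t

  labelling-path : ∀ (G : Instance σ) ps → (∀ {R t} → (R , t) ∈ ps → t ∈ G R) →
                   ∀ {x y} → labelling ps x ≡ labelling ps y → Star (Adjacent G) x y
  labelling-path G [] _ refl = ε
  labelling-path G ((R , t) ∷ ps) ps⊆G {x} {y} eq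
    with hits? (labelling ps) t (labelling ps x) | hits? (labelling ps) t (labelling ps y)
  ... | yes hx | yes hy =
    let z , z∈t , lx≡lz = VM.find hx
        w , w∈t , ly≡lw = VM.find hy
    in path lx≡lz ◅◅ (R , t , ps⊆G (here refl) , z∈t , w∈t) ◅ Star.reverse (Adjacent-sym G) (path ly≡lw)
    where path = labelling-path G ps (ps⊆G ∘ there)
  ... | no ¬hx | no ¬hy = labelling-path G ps (ps⊆G ∘ there)
    (≡.trans (sym (relabel-miss _ t ¬hx)) (≡.trans eq (relabel-miss _ t ¬hy)))
  ... | yes hx | no ¬hy =
    ⊥-elim (¬hy (≡.subst (Hits _ t) (≡.trans eq (relabel-miss _ t ¬hy)) (hits-relabel _ t hx)))
  ... | no ¬hx | yes hy =
    ⊥-elim (¬hx (≡.subst (Hits _ t) (≡.trans (sym eq) (relabel-miss _ t ¬hx)) (hits-relabel _ t hy)))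

  TupleTest : Set
  TupleTest = ∀ {n} → Vec ℕ n → Bool

  _∣_ : Instance σ → TupleTest → Instance σ
  (A ∣ b) R = filter (λ t → T? (b t)) (A R)

  ∈-∣ : ∀ (A : Instance σ) (b : TupleTest) {R t} → t ∈ (A ∣ b) R ⇔ (t ∈ A R × T (b t))
  ∈-∣ A b {R} =
    mk⇔ (∈-filter⁻ (λ t → T? (b t)) {xs = A R}) (λ (t∈ , bt) → ∈-filter⁺ (λ t → T? (b t)) t∈ bt)

  _∧ᵗ_ : TupleTest → TupleTest → TupleTest
  (b ∧ᵗ c) t = b t ∧ c t

  notᵗ : TupleTest → TupleTest
  notᵗ b t = not (b t)

  ∈-∣-∧ᵗ : ∀ (A : Instance σ) (b c : TupleTest) {R t} →
           t ∈ (A ∣ (b ∧ᵗ c)) R → t ∈ A R × T (b t) × T (c t)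
  ∈-∣-∧ᵗ A b c t∈ =
    let t∈A , bct = Equivalence.to (∈-∣ A (b ∧ᵗ c)) t∈ in t∈A , Equivalence.to T-∧ bct

  module Components (G : Instance σ) where

    tuples : List Tuple
    tuples = concatMap (λ R → map (R ,_) (G R)) (allFin (nsym σ))

    ∈-tuples⁺ : ∀ {R t} → t ∈ G R → (R , t) ∈ tuples
    ∈-tuples⁺ {R} t∈ = ∈-concatMap⁺ (λ R → map (R ,_) (G R)) (lose (∈-allFin R) (∈-map⁺ (R ,_) t∈))

    ∈-tuples⁻ : ∀ {R t} → (R , t) ∈ tuples → t ∈ G R
    ∈-tuples⁻ p with R′ , _ , q ← find (∈-concatMap⁻ (λ R → map (R ,_) (G R)) {xs = allFin (nsym σ)} p)
                with _ , t∈ , refl ← ∈-map⁻ (R′ ,_) q = t∈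

    label : ℕ → ℕ
    label = labelling tuples

    label-tuple : ∀ {R t x y} → t ∈ G R → x VM.∈ t → y VM.∈ t → label x ≡ label y
    label-tuple = labelling-tuple ∘ ∈-tuples⁺

    label-path : ∀ {x y} → label x ≡ label y → Star (Adjacent G) x y
    label-path = labelling-path G tuples ∈-tuples⁻

    meets : ℕ → TupleTest
    meets a t = ⌊ VAny.any? (λ z → label z ≟ label a) t ⌋

    meets-via : ∀ {a R t x} → t ∈ G R → x VM.∈ t → T (meets a t) ⇔ label x ≡ label a
    meets-via t∈ x∈t = mk⇔
      (λ m → let z , z∈t , lz≡la = VM.find (toWitness m) in ≡.trans (label-tuple t∈ x∈t z∈t) lz≡la)
      (λ lx≡la → fromWitness (VM.lose x∈t lx≡la))

    LabelInvariant : TupleTest → Set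
    LabelInvariant b = ∀ {R R′ t t′ x x′} → t ∈ G R → t′ ∈ G R′ → x VM.∈ t → x′ VM.∈ t′ →
                       label x ≡ label x′ → b t ≡ b t′

    meets-invariant : ∀ a → LabelInvariant (meets a)
    meets-invariant a t∈ t′∈ x∈t x′∈t′ lx≡lx′ = T-injective (⇔-trans (meets-via t∈ x∈t)
      (⇔-trans (mk⇔ (≡.trans (sym lx≡lx′)) (≡.trans lx≡lx′)) (⇔-sym (meets-via t′∈ x′∈t′))))

    ∧ᵗ-invariant : ∀ (b c : TupleTest) → LabelInvariant b → LabelInvariant c → LabelInvariant (b ∧ᵗ c)
    ∧ᵗ-invariant b c inv-b inv-c t∈ t′∈ x∈t x′∈t′ e =
      cong₂ _∧_ (inv-b t∈ t′∈ x∈t x′∈t′ e) (inv-c t∈ t′∈ x∈t x′∈t′ e)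

    notᵗ-invariant : ∀ (b : TupleTest) → LabelInvariant b → LabelInvariant (notᵗ b)
    notᵗ-invariant b inv t∈ t′∈ x∈t x′∈t′ e = cong not (inv t∈ t′∈ x∈t x′∈t′ e)

    components : (as : List ℕ) → TupleTest → Vec (Instance σ) (suc (length as))
    components []       b = G ∣ b V.∷ V.[]
    components (a ∷ as) b = G ∣ (b ∧ᵗ meets a) V.∷ components as (b ∧ᵗ notᵗ (meets a))

    ∣-split : ∀ (b c : TupleTest) → IsUnion (G ∣ b) (G ∣ (b ∧ᵗ c)) (G ∣ (b ∧ᵗ notᵗ c))
    ∣-split b c R t = mk⇔ to [ weaken c , weaken (notᵗ c) ]
      where
      to : t ∈ (G ∣ b) R → t ∈ (G ∣ (b ∧ᵗ c)) R ⊎ t ∈ (G ∣ (b ∧ᵗ notᵗ c)) R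
      to t∈ with t∈G , bt ← Equivalence.to (∈-∣ G b) t∈ =
        Sum.map (λ bct → Equivalence.from (∈-∣ G (b ∧ᵗ c)) (t∈G , bct))
                (λ bct → Equivalence.from (∈-∣ G (b ∧ᵗ notᵗ c)) (t∈G , bct))
                (T-∧-split (b t) (c t) bt)
      weaken : ∀ (c′ : TupleTest) → t ∈ (G ∣ (b ∧ᵗ c′)) R → t ∈ (G ∣ b) R
      weaken c′ t∈ with t∈G , bt , _ ← ∈-∣-∧ᵗ G b c′ t∈ = Equivalence.from (∈-∣ G b) (t∈G , bt)

    ∣-disjoint : ∀ (b c : TupleTest) → LabelInvariant c → DisjointAdoms (G ∣ (b ∧ᵗ c)) (G ∣ (b ∧ᵗ notᵗ c))
    ∣-disjoint b c inv (_ , _ , t∈ , x∈t) (_ , _ , t′∈ , x∈t′)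
      with t∈G , _ , ct ← ∈-∣-∧ᵗ G b c t∈ | t′∈G , _ , nct′ ← ∈-∣-∧ᵗ G b (notᵗ c) t′∈ =
      T-not⇒¬T nct′ (≡.subst T (inv t∈G t′∈G x∈t x∈t′ refl) ct)

    homN-components : ∀ D as (b : TupleTest) →
                      homN (G ∣ b) D ≡ prod ℕˢ (V.map (λ P → homN P D) (components as b))
    homN-components D []       b = sym (*-identityʳ _)
    homN-components D (a ∷ as) b =
      ≡.trans (homN-∪ D (∣-split b (meets a)) (∣-disjoint b (meets a) (meets-invariant a)))
              (cong (homN (G ∣ (b ∧ᵗ meets a)) D *_) (homN-components D as (b ∧ᵗ notᵗ (meets a))))

    restrict-path : ∀ (c : TupleTest) {ℓ} → (∀ {R t u} → t ∈ G R → u VM.∈ t → label u ≡ ℓ → T (c t)) →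
                    ∀ {x y} → label x ≡ ℓ → Star (Adjacent G) x y → Star (Adjacent (G ∣ c)) x y
    restrict-path c ok lx≡ℓ ε = ε
    restrict-path c ok lx≡ℓ ((R , t , t∈ , x∈t , y∈t) ◅ path) =
      (R , t , Equivalence.from (∈-∣ G c) (t∈ , ok t∈ x∈t lx≡ℓ) , x∈t , y∈t)
      ◅ restrict-path c ok (≡.trans (label-tuple t∈ y∈t x∈t) lx≡ℓ) path

    component-connected : ∀ (b : TupleTest) a → LabelInvariant b → Connected (G ∣ (b ∧ᵗ meets a))
    component-connected b a inv x y (_ , _ , t∈ , x∈t) (_ , _ , t′∈ , y∈t′)
      with t∈G , bt , mt ← ∈-∣-∧ᵗ G b (meets a) t∈ | t′∈G , _ , mt′ ← ∈-∣-∧ᵗ G b (meets a) t′∈ =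
      restrict-path (b ∧ᵗ meets a) ok lx≡la (label-path (≡.trans lx≡la (sym ly≡la)))
      where
      lx≡la = Equivalence.to (meets-via t∈G x∈t) mt
      ly≡la = Equivalence.to (meets-via t′∈G y∈t′) mt′
      ok : ∀ {R t u} → t ∈ G R → u VM.∈ t → label u ≡ label a → T (b t ∧ meets a t)
      ok u∈G u∈ lu≡la = Equivalence.from T-∧
        ( ≡.subst T (inv t∈G u∈G x∈t u∈ (≡.trans lx≡la (sym lu≡la))) bt
        , Equivalence.from (meets-via u∈G u∈) lu≡la)

    components-connected : ∀ as (b : TupleTest) → LabelInvariant b → (∀ {x} → x ∈adom (G ∣ b) → x ∈ as) →
                           ∀ i → Connected (V.lookup (components as b) i)
    components-connected []       b inv covered fzero    x _ x∈ _ = ⊥-elim (¬Any[] (covered x∈))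
    components-connected (a ∷ as) b inv covered fzero    = component-connected b a inv
    components-connected (a ∷ as) b inv covered (fsuc i) =
      components-connected as (b ∧ᵗ notᵗ (meets a))
        (∧ᵗ-invariant b (notᵗ (meets a)) inv (notᵗ-invariant (meets a) (meets-invariant a))) covered′ i
      where
      covered′ : ∀ {x} → x ∈adom (G ∣ (b ∧ᵗ notᵗ (meets a))) → x ∈ as
      covered′ (R , t , t∈ , x∈t) with t∈G , bt , nmt ← ∈-∣-∧ᵗ G b (notᵗ (meets a)) t∈
        with covered (R , t , Equivalence.from (∈-∣ G b) (t∈G , bt) , x∈t)
      ... | there x∈as = x∈as
      ... | here refl  = ⊥-elim (T-not⇒¬T nmt (Equivalence.from (meets-via t∈G x∈t) refl))

  open Components using (components; homN-components; components-connected)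

  decompose : (as : List ℕ) → Instance σ → Vec (Instance σ) (suc (length as))
  decompose as G = components G as (λ _ → true)

  homK-decompose : ∀ K as (G D : Instance σ) → homK K G D ≡ prod K (V.map (λ P → homK K P D) (decompose as G))
  homK-decompose K as G D = begin
    homK K G D                                 ≡⟨ homK≡fromℕ-homN K G D ⟩
    fromℕ K (homN G D)                         ≡⟨ cong (fromℕ K) (homN-cong D G≈G∣true) ⟩
    fromℕ K (homN (G ∣ (λ _ → true)) D)        ≡⟨ cong (fromℕ K) (homN-components G D as _) ⟩
    fromℕ K (prod ℕˢ (V.map homN-D pieces))    ≡⟨ fromℕ-prod K (V.map homN-D pieces) ⟩
    prod K (V.map (fromℕ K) (V.map homN-D pieces))
      ≡⟨ cong (prod K) (≡.trans (sym (V.map-∘ (fromℕ K) homN-D pieces))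
                               (V.map-cong (λ P → sym (homK≡fromℕ-homN K P D)) pieces)) ⟩
    prod K (V.map (λ P → homK K P D) pieces) ∎
    where
    open ≡-Reasoning
    pieces = decompose as G
    homN-D : Instance σ → ℕ
    homN-D P = homN P D
    G≈G∣true : SameTuples G (G ∣ (λ _ → true))
    G≈G∣true R t = mk⇔ (λ t∈ → Equivalence.from (∈-∣ G _) (t∈ , _)) (proj₁ ∘ Equivalence.to (∈-∣ G _))

  decompose-connected : ∀ as (G : Instance σ) → (∀ {x} → x ∈adom G → x ∈ as) →
                        ∀ i → Connected (V.lookup (decompose as G) i)
  decompose-connected as G covered = components-connected G as _ (λ _ _ _ _ _ → refl)
    (λ (R , t , t∈ , x∈t) → covered (R , t , proj₁ (Equivalence.to (∈-∣ G _) t∈) , x∈t))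

  -- Query algorithms with connected instances

  IsLeftQueryAlg-reduce : ∀ {K C k m} {F : Vec (Instance σ) k} {F′ : Vec (Instance σ) m} {X}
    (g : Vec (Carrier K) m → Vec (Carrier K) k) →
    (∀ D → g (V.map (λ P → homK K P D) F′) ≡ V.map (λ P → homK K P D) F) →
    IsLeftQueryAlg K C k F X → IsLeftQueryAlg K C m F′ (X ∘ g)
  IsLeftQueryAlg-reduce {X = X} g g-hom alg D =
    ≡.subst X (sym (g-hom D)) ∘ proj₁ (alg D) , proj₂ (alg D) ∘ ≡.subst X (g-hom D)

  module _ {k : ℕ} (F : Vec (Instance σ) k) where

    adomsOf : List ℕ
    adomsOf = concatMap adomList (V.toList F)

    width : ℕ
    width = suc (length adomsOf)

    piece : Fin k → Fin width → Instance σ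
    piece i = V.lookup (decompose adomsOf (V.lookup F i))

    pieces : Vec (Instance σ) (k * width)
    pieces = V.tabulate (uncurry piece ∘ remQuot width)

    pieces-connected : ∀ ij → Connected (V.lookup pieces ij)
    pieces-connected ij = ≡.subst Connected (sym (V.lookup∘tabulate (uncurry piece ∘ remQuot width) ij))
      (decompose-connected adomsOf (V.lookup F i) covered j)
      where
      i = proj₁ (remQuot {k} width ij)
      j = proj₂ (remQuot {k} width ij)
      covered : ∀ {x} → x ∈adom V.lookup F i → x ∈ adomsOf
      covered x∈ =
        ∈-concatMap⁺ adomList (lose (∈-toList⁺ (∈-lookup i F)) (Equivalence.from (∈-adomList _) x∈))

    regroup : ∀ K → Vec (Carrier K) (k * width) → Vec (Carrier K) k
    regroup K w = V.tabulate (λ i → prod K (V.tabulate (λ j → V.lookup w (combine i j))))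

    regroup-hom : ∀ K D → regroup K (V.map (λ P → homK K P D) pieces) ≡ V.map (λ P → homK K P D) F
    regroup-hom K D = ≡.trans (V.tabulate-cong regroup-at) (tabulate-lookup-map h F)
      where
      h : Instance σ → Carrier K
      h P = homK K P D
      regroup-at : ∀ i → prod K (V.tabulate (λ j → V.lookup (V.map h pieces) (combine i j))) ≡ h (V.lookup F i)
      regroup-at i = begin
        prod K (V.tabulate (λ j → V.lookup (V.map h pieces) (combine i j)))
          ≡⟨ cong (prod K) (V.tabulate-cong λ j → ≡.trans (V.lookup-map (combine i j) h pieces)
               (cong h (≡.trans (V.lookup∘tabulate _ (combine i j)) (cong (uncurry piece) (remQuot-combine i j))))) ⟩
        prod K (V.tabulate (h ∘ piece i))
          ≡⟨ cong (prod K) (tabulate-lookup-map h (decompose adomsOf (V.lookup F i))) ⟩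
        prod K (V.map h (decompose adomsOf (V.lookup F i)))
          ≡⟨ homK-decompose K adomsOf (V.lookup F i) D ⟨
        h (V.lookup F i) ∎
        where open ≡-Reasoning

proposition3 : (σ : Schema) (C : Class σ) (K : Semiring) →
    AdmitsLQA K C ⇔ AdmitsConnectedLQA K C
proposition3 σ C K = mk⇔ connect forget
  where
  connect : AdmitsLQA K C → AdmitsConnectedLQA K C
  connect (suc k , _ , F , X , alg) =
    suc k * width F , s≤s z≤n , pieces F , X ∘ regroup F K , pieces-connected F ,
    IsLeftQueryAlg-reduce {C = C} {F′ = pieces F} {X = X} (regroup F K) (regroup-hom F K) alg
  forget : AdmitsConnectedLQA K C → AdmitsLQA K C
  forget (k , k>0 , F , X , _ , alg) = k , k>0 , F , X , alg
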